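{- If there is a term $t$ with $x_1:P_1,\dots,x_n:P_n\vdash_{\mathrm{PRJ}} t:Q$, then $\lfloor P_1\rfloor,\dots,\lfloor P_n\rfloor\vdash\lfloor Q\rfloor$ is derivable in the intuitionistic second-order natural deduction system $\mathrm{NJ}$, where $\lfloor A^{+}\rfloor=\lfloor A^{\oplus}\rfloor=A$ and $\lfloor A^{ - }\rfloor=\lfloor A^{\ominus}\rfloor=\neg A$.
   Context: Pure types: given a denumerable set of type variables $\alpha,\beta,\dots$, pure types are $A,B ::= \alpha \mid A\wedge B \mid A\vee B \mid A\to B \mid A\ltimes B \mid \neg A \mid \forall\alpha.A \mid \exists\alpha.A$ (quantifiers bind $\alpha$; $A[\alpha:=B]$ capture-avoiding substitution; $\mathrm{ftv}$ free type variables). Types are $P,Q ::= A^{+}\mid A^{ - }\mid A^{\oplus}\mid A^{\ominus}$ (modes only at the root); $B^{\oplus}[\alpha:=A]$ means $(B[\alpha:=A])^{\oplus}$, etc. Terms ($\varepsilon\in\{+,-\}$, $i\in\{1,2\}$): $t,s,u ::= x \mid t \mathbin{\#}^{P} s \mid \lambda^{\varepsilon}_{\circ}(x:P).t \mid t \circ^{\varepsilon} s \mid \langle t,s\rangle^{\varepsilon} \mid \pi^{\varepsilon}_i(t) \mid \mathrm{in}^{\varepsilon}_i(t) \mid \mathrm{case}^{\varepsilon}\, t\,[x:P.\,s \mid y:Q.\,u] \mid \lambda^{\varepsilon}(x:P).t \mid t @^{\varepsilon} s \mid \langle\!\langle t,s\rangle\!\rangle^{\varepsilon} \mid \mathrm{colam}^{\varepsilon}\,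 t\,[x:P,y:Q.\,s] \mid \neg\mathrm{I}^{\varepsilon}(t) \mid \neg\mathrm{E}^{\varepsilon}(t) \mid \Lambda^{\varepsilon}\alpha.t \mid t[A]^{\varepsilon} \mid \langle A,t\rangle^{\varepsilon} \mid \mathrm{open}^{\varepsilon}\, t \text{ as } (\alpha,x:P) \text{ in } s$, with evident binders, up to $\alpha$-renaming. A typing context $\Gamma$ is a finite assignment $x_1:P_1,\dots,x_n:P_n$. Typing judgments $\Gamma\vdash t:P$ of $\lambda^{\mathrm{PRK}}$ are derived by the rules: (Ax) $\Gamma,x:P\vdash x:P$. (Abs) if $\Gamma\vdash t:A^{+}$ and $\Gamma\vdash s:A^{ - }$ then $\Gamma\vdash t\mathbin{\#}^{P}s:P$ for any $P$. (Weak) if $\Gamma,x:A^{\ominus}\vdash t:A^{+}$ then $\Gamma\vdash\lambda^{+}_{\circ}(x:A^{\ominus}).t:A^{\oplus}$; if $\Gamma,x:A^{\oplus}\vdash t:A^{ - }$ then $\Gamma\vdash\lambda^{ - }_{\circ}(x:A^{\oplus}).t:A^{\ominus}$; if $\Gamma\vdash t:A^{\oplus}$, $\Gamma\vdash s:A^{\ominus}$ then $\Gamma\vdash t\circ^{+}s:A^{+}$; if $\Gamma\vdash t:A^{\ominus}$, $\Gamma\vdash s:A^{\oplus}$ then $\Gamma\vdash t\circ^{ - }s:A^{ - }$. (Pairs) from $t:A^{\oplus}$, $s:B^{\oplus}$ infer $\langle t,s\rangle^{+}:(A\wedge B)^{+}$; from $t:A^{\ominus}$, $s:B^{\ominus}$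 infer $\langle t,s\rangle^{ - }:(A\vee B)^{ - }$; from $t:(A_1\wedge A_2)^{+}$ infer $\pi^{+}_i(t):A_i^{\oplus}$; from $t:(A_1\vee A_2)^{ - }$ infer $\pi^{ - }_i(t):A_i^{\ominus}$ (same $\Gamma$ throughout). (Injections) from $t:A_i^{\oplus}$ infer $\mathrm{in}^{+}_i(t):(A_1\vee A_2)^{+}$; from $t:A_i^{\ominus}$ infer $\mathrm{in}^{ - }_i(t):(A_1\wedge A_2)^{ - }$; if $\Gamma\vdash t:(A\vee B)^{+}$, $\Gamma,x:A^{\oplus}\vdash s:P$, $\Gamma,y:B^{\oplus}\vdash u:P$ then $\Gamma\vdash\mathrm{case}^{+}t[x:A^{\oplus}.s\mid y:B^{\oplus}.u]:P$; if $\Gamma\vdash t:(A\wedge B)^{ - }$, $\Gamma,x:A^{\ominus}\vdash s:P$, $\Gamma,y:B^{\ominus}\vdash u:P$ then $\Gamma\vdash\mathrm{case}^{ - }t[x:A^{\ominus}.s\mid y:B^{\ominus}.u]:P$. (Implication/co-implication) if $\Gamma,x:A^{\oplus}\vdash t:B^{\oplus}$ then $\Gamma\vdash\lambda^{+}(x:A^{\oplus}).t:(A\to B)^{+}$; if $\Gamma,x:A^{\ominus}\vdash t:B^{\ominus}$ then $\Gamma\vdash\lambda^{ - }(x:A^{\ominus}).t:(A\ltimes B)^{ - }$; from $t:(A\to B)^{+}$, $s:A^{\oplus}$ infer $t@^{+}s:B^{\oplus}$; from $t:(A\ltimes B)^{ - }$, $s:A^{\ominus}$ infer $t@^{ - }s:B^{\ominus}$;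 from $t:A^{\ominus}$, $s:B^{\oplus}$ infer $\langle\!\langle t,s\rangle\!\rangle^{+}:(A\ltimes B)^{+}$; from $t:A^{\oplus}$, $s:B^{\ominus}$ infer $\langle\!\langle t,s\rangle\!\rangle^{ - }:(A\to B)^{ - }$; if $\Gamma\vdash t:(A\ltimes B)^{+}$ and $\Gamma,x:A^{\ominus},y:B^{\oplus}\vdash s:P$ then $\Gamma\vdash\mathrm{colam}^{+}t[x:A^{\ominus},y:B^{\oplus}.s]:P$; if $\Gamma\vdash t:(A\to B)^{ - }$ and $\Gamma,x:A^{\oplus},y:B^{\ominus}\vdash s:P$ then $\Gamma\vdash\mathrm{colam}^{ - }t[x:A^{\oplus},y:B^{\ominus}.s]:P$. (Negation) from $t:A^{\ominus}$ infer $\neg\mathrm{I}^{+}(t):(\neg A)^{+}$; from $t:A^{\oplus}$ infer $\neg\mathrm{I}^{ - }(t):(\neg A)^{ - }$; from $t:(\neg A)^{+}$ infer $\neg\mathrm{E}^{+}(t):A^{\ominus}$; from $t:(\neg A)^{ - }$ infer $\neg\mathrm{E}^{ - }(t):A^{\oplus}$. (Quantifiers) if $\Gamma\vdash t:A^{\oplus}$, $\alpha\notin\mathrm{ftv}(\Gamma)$ then $\Gamma\vdash\Lambda^{+}\alpha.t:(\forall\alpha.A)^{+}$; if $\Gamma\vdash t:A^{\ominus}$, $\alpha\notin\mathrm{ftv}(\Gamma)$ then $\Gamma\vdash\Lambda^{ - }\alpha.t:(\exists\alpha.A)^{ - }$; from $t:(\forall\alpha.B)^{+}$ infer $t[A]^{+}:B^{\oplus}[\alpha:=A]$;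 from $t:(\exists\alpha.B)^{ - }$ infer $t[A]^{ - }:B^{\ominus}[\alpha:=A]$; from $t:B^{\oplus}[\alpha:=A]$ infer $\langle A,t\rangle^{+}:(\exists\alpha.B)^{+}$; from $t:B^{\ominus}[\alpha:=A]$ infer $\langle A,t\rangle^{ - }:(\forall\alpha.B)^{ - }$; if $\Gamma\vdash t:(\exists\alpha.A)^{+}$, $\Gamma,x:A^{\oplus}\vdash s:P$, $\alpha\notin\mathrm{ftv}(\Gamma,P)$ then $\Gamma\vdash\mathrm{open}^{+}t\text{ as }(\alpha,x:A^{\oplus})\text{ in }s:P$; if $\Gamma\vdash t:(\forall\alpha.A)^{ - }$, $\Gamma,x:A^{\ominus}\vdash s:P$, $\alpha\notin\mathrm{ftv}(\Gamma,P)$ then $\Gamma\vdash\mathrm{open}^{ - }t\text{ as }(\alpha,x:A^{\ominus})\text{ in }s:P$. Intuitionistic terms: an occurrence of a subterm (or variable) in a term $t$ is useless if it lies inside the argument $s$ of some subterm of $t$ of the form $u\circ^{+}s$; otherwise it is useful. A term $t$ is intuitionistic iff (1) $t$ has no useful subterm of any of the forms $\mathrm{case}^{ - }\,r\,[x.s\mid y.u]$, $\mathrm{colam}^{ - }\,r\,[x,y.s]$, $\neg\mathrm{E}^{ - }(r)$, $\mathrm{open}^{ - }\,r\text{ as }(\alpha,x)\text{ in }s$; and (2) for every useful subterm of the form $\lambda^{+}_{\circ}(x:A^{\ominus}).r$, there is no useful occurrence of $x$ in $r$. $\Gamma\vdash_{\mathrm{PRJ}} t:P$ means $\Gamma\vdash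 t:P$ is derivable in $\lambda^{\mathrm{PRK}}$ and $t$ is intuitionistic. $\mathrm{NJ}$: formulas $A ::= \alpha\mid\bot\mid A\wedge A\mid A\vee A\mid A\to A\mid A\ltimes A\mid\neg A\mid\forall\alpha.A\mid\exists\alpha.A$ (pure types are formulas); sequents $\Gamma\vdash A$; rules: axiom $\Gamma,A\vdash A$; $\bot$-elimination; standard natural-deduction introduction/elimination rules for $\wedge,\vee,\to$; $\neg$-introduction ($\Gamma,A\vdash\bot$ gives $\Gamma\vdash\neg A$) and $\neg$-elimination ($\Gamma\vdash\neg A$, $\Gamma\vdash A$ give $\Gamma\vdash\bot$); $\ltimes$-introduction ($\Gamma\vdash\neg A$, $\Gamma\vdash B$ give $\Gamma\vdash A\ltimes B$) and $\ltimes$-elimination ($\Gamma\vdash A\ltimes B$ and $\Gamma,\neg A,B\vdash C$ give $\Gamma\vdash C$); $\forall$-introduction (from $\Gamma\vdash A$ with $\alpha\notin\mathrm{ftv}(\Gamma)$ infer $\Gamma\vdash\forall\alpha.A$), $\forall$-elimination (from $\Gamma\vdash\forall\alpha.B$ infer $\Gamma\vdash B[\alpha:=A]$), $\exists$-introduction (from $\Gamma\vdash B[\alpha:=A]$ infer $\Gamma\vdash\exists\alpha.B$), $\exists$-elimination (from $\Gamma\vdash\exists\alpha.A$ and $\Gamma,A\vdash B$ with $\alpha\notin\mathrm{ftv}(\Gamma,B)$ infer $\Gamma\vdash B$). No excluded middle. -}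

module Defs where

open import Data.Nat using (ℕ; zero; suc; pred; _<ᵇ_; _≡ᵇ_)
open import Data.Bool using (if_then_else_)
open import Data.List using (List; []; _∷_; map)
open import Data.List.Membership.Propositional using (_∈_)
open import Data.Product using (_×_)
open import Data.Unit using (⊤)
open import Data.Empty using (⊥)
open import Relation.Binary.PropositionalEquality using (_≡_)
open import Relation.Nullary using (¬_)

-- Pure types (type variables as de Bruijn indices; ∀/∃ bind index 0)

infixr 30 _∧_
infixr 25 _∨_
infixr 20 _⇒_ _⋉_

data Ty : Set where
  tv   : ℕ → Ty
  _∧_  : Ty → Ty → Ty
  _∨_  : Ty → Ty → Ty
  _⇒_  : Ty → Ty → Ty
  _⋉_  : Ty → Ty → Ty
  ¬ᵗ   : Ty → Ty
  ∀ᵗ   : Ty → Ty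
  ∃ᵗ   : Ty → Ty

shift : ℕ → Ty → Ty
shift c (tv n)  = if n <ᵇ c then tv n else tv (suc n)
shift c (A ∧ B) = shift c A ∧ shift c B
shift c (A ∨ B) = shift c A ∨ shift c B
shift c (A ⇒ B) = shift c A ⇒ shift c B
shift c (A ⋉ B) = shift c A ⋉ shift c B
shift c (¬ᵗ A)  = ¬ᵗ (shift c A)
shift c (∀ᵗ A)  = ∀ᵗ (shift (suc c) A)
shift c (∃ᵗ A)  = ∃ᵗ (shift (suc c) A)

-- subst j A B : replace variable j by A (A already lives under j binders),
-- decrementing the variables above j (capture-avoiding by construction)
subst : ℕ → Ty → Ty → Ty
subst j A (tv n)  = if n <ᵇ j then tv n else (if n ≡ᵇ j then A else tv (pred n))
subst j A (B ∧ C) = subst j A B ∧ subst j A C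
subst j A (B ∨ C) = subst j A B ∨ subst j A C
subst j A (B ⇒ C) = subst j A B ⇒ subst j A C
subst j A (B ⋉ C) = subst j A B ⋉ subst j A C
subst j A (¬ᵗ B)  = ¬ᵗ (subst j A B)
subst j A (∀ᵗ B)  = ∀ᵗ (subst (suc j) (shift 0 A) B)
subst j A (∃ᵗ B)  = ∃ᵗ (subst (suc j) (shift 0 A) B)

-- B [ A ] : B[α:=A] where α is the variable bound by the enclosing quantifier
_[_] : Ty → Ty → Ty
B [ A ] = subst 0 A B

data Mode : Set where
  ⁺ ⁻ ⊕ ⊖ : Mode

record MTy : Set where
  constructor _^_
  field
    ty   : Ty
    mode : Mode
open MTy public

infix 15 _^_

shiftM : MTy -> MTy
shiftM (A ^ m) = shift 0 A ^ m

-- context under a new type binder (α ∉ ftv(Γ) in the named presentation)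
↑Γ : List MTy → List MTy
↑Γ = map shiftM

-- Terms (term variables as de Bruijn indices)

data Sign : Set where
  pos neg : Sign

data Idx : Set where
  i₁ i₂ : Idx

sel : Idx → Ty → Ty → Ty
sel i₁ A B = A
sel i₂ A B = B

data Term : Set where
  var    : ℕ → Term
  abs    : Term → MTy → Term → Term
  lamo   : Sign → MTy → Term → Term                 -- λ^ε_∘ (x:P). t         (binds x)
  appo   : Sign → Term → Term → Term
  pair   : Sign → Term → Term → Term
  proj   : Sign → Idx → Term → Term
  inj    : Sign → Idx → Term → Term
  case   : Sign → Term → MTy → Term → MTy → Term → Term
                                                    -- case^ε t [x:P. s | y:Q. u]  (x binds in s, y in u)
  lam    : Sign → MTy → Term → Term                 -- λ^ε (x:P). t           (binds x)
  app    : Sign → Term → Term → Term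
  cpair  : Sign → Term → Term → Term
  colam  : Sign → Term → MTy → MTy → Term → Term    -- colam^ε t [x:P, y:Q. s]
                                                    --   in s: y is index 0, x is index 1
  negI   : Sign → Term → Term
  negE   : Sign → Term → Term
  tlam   : Sign → Term → Term                       -- Λ^ε α. t               (binds type var 0)
  tapp   : Sign → Term → Ty → Term
  pack   : Sign → Ty → Term → Term
  open'  : Sign → Term → MTy → Term → Term          -- open^ε t as (α, x:P) in s
                                                    --   (binds type var 0 in P, s; x in s)

data _∋_∶_ : List MTy → ℕ → MTy → Set where
  here  : ∀ {Γ P} → (P ∷ Γ) ∋ 0 ∶ P
  there : ∀ {Γ P Q x} → Γ ∋ x ∶ P → (Q ∷ Γ) ∋ suc x ∶ P

infix 4 _⊢_∶_ _∋_∶_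

data _⊢_∶_ : List MTy → Term → MTy → Set where
  ax      : ∀ {Γ x P} → Γ ∋ x ∶ P → Γ ⊢ var x ∶ P
  absurd  : ∀ {Γ t s A} P → Γ ⊢ t ∶ A ^ ⁺ → Γ ⊢ s ∶ A ^ ⁻ → Γ ⊢ abs t P s ∶ P
  lamo⁺   : ∀ {Γ t A} → (A ^ ⊖ ∷ Γ) ⊢ t ∶ A ^ ⁺ → Γ ⊢ lamo pos (A ^ ⊖) t ∶ A ^ ⊕
  lamo⁻   : ∀ {Γ t A} → (A ^ ⊕ ∷ Γ) ⊢ t ∶ A ^ ⁻ → Γ ⊢ lamo neg (A ^ ⊕) t ∶ A ^ ⊖
  appo⁺   : ∀ {Γ t s A} → Γ ⊢ t ∶ A ^ ⊕ → Γ ⊢ s ∶ A ^ ⊖ → Γ ⊢ appo pos t s ∶ A ^ ⁺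
  appo⁻   : ∀ {Γ t s A} → Γ ⊢ t ∶ A ^ ⊖ → Γ ⊢ s ∶ A ^ ⊕ → Γ ⊢ appo neg t s ∶ A ^ ⁻
  pair⁺   : ∀ {Γ t s A B} → Γ ⊢ t ∶ A ^ ⊕ → Γ ⊢ s ∶ B ^ ⊕ → Γ ⊢ pair pos t s ∶ (A ∧ B) ^ ⁺
  pair⁻   : ∀ {Γ t s A B} → Γ ⊢ t ∶ A ^ ⊖ → Γ ⊢ s ∶ B ^ ⊖ → Γ ⊢ pair neg t s ∶ (A ∨ B) ^ ⁻
  proj⁺   : ∀ {Γ t A₁ A₂} i → Γ ⊢ t ∶ (A₁ ∧ A₂) ^ ⁺ → Γ ⊢ proj pos i t ∶ sel i A₁ A₂ ^ ⊕
  proj⁻   : ∀ {Γ t A₁ A₂} i → Γ ⊢ t ∶ (A₁ ∨ A₂) ^ ⁻ → Γ ⊢ proj neg i t ∶ sel i A₁ A₂ ^ ⊖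
  inj⁺    : ∀ {Γ t} A₁ A₂ i → Γ ⊢ t ∶ sel i A₁ A₂ ^ ⊕ → Γ ⊢ inj pos i t ∶ (A₁ ∨ A₂) ^ ⁺
  inj⁻    : ∀ {Γ t} A₁ A₂ i → Γ ⊢ t ∶ sel i A₁ A₂ ^ ⊖ → Γ ⊢ inj neg i t ∶ (A₁ ∧ A₂) ^ ⁻
  case⁺   : ∀ {Γ t s u A B P} → Γ ⊢ t ∶ (A ∨ B) ^ ⁺ → (A ^ ⊕ ∷ Γ) ⊢ s ∶ P → (B ^ ⊕ ∷ Γ) ⊢ u ∶ P
            → Γ ⊢ case pos t (A ^ ⊕) s (B ^ ⊕) u ∶ P
  case⁻   : ∀ {Γ t s u A B P} → Γ ⊢ t ∶ (A ∧ B) ^ ⁻ → (A ^ ⊖ ∷ Γ) ⊢ s ∶ P → (B ^ ⊖ ∷ Γ) ⊢ u ∶ P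
            → Γ ⊢ case neg t (A ^ ⊖) s (B ^ ⊖) u ∶ P
  lam⁺    : ∀ {Γ t A B} → (A ^ ⊕ ∷ Γ) ⊢ t ∶ B ^ ⊕ → Γ ⊢ lam pos (A ^ ⊕) t ∶ (A ⇒ B) ^ ⁺
  lam⁻    : ∀ {Γ t A B} → (A ^ ⊖ ∷ Γ) ⊢ t ∶ B ^ ⊖ → Γ ⊢ lam neg (A ^ ⊖) t ∶ (A ⋉ B) ^ ⁻
  app⁺    : ∀ {Γ t s A B} → Γ ⊢ t ∶ (A ⇒ B) ^ ⁺ → Γ ⊢ s ∶ A ^ ⊕ → Γ ⊢ app pos t s ∶ B ^ ⊕
  app⁻    : ∀ {Γ t s A B} → Γ ⊢ t ∶ (A ⋉ B) ^ ⁻ → Γ ⊢ s ∶ A ^ ⊖ → Γ ⊢ app neg t s ∶ B ^ ⊖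
  cpair⁺  : ∀ {Γ t s A B} → Γ ⊢ t ∶ A ^ ⊖ → Γ ⊢ s ∶ B ^ ⊕ → Γ ⊢ cpair pos t s ∶ (A ⋉ B) ^ ⁺
  cpair⁻  : ∀ {Γ t s A B} → Γ ⊢ t ∶ A ^ ⊕ → Γ ⊢ s ∶ B ^ ⊖ → Γ ⊢ cpair neg t s ∶ (A ⇒ B) ^ ⁻
  colam⁺  : ∀ {Γ t s A B P} → Γ ⊢ t ∶ (A ⋉ B) ^ ⁺ → (B ^ ⊕ ∷ A ^ ⊖ ∷ Γ) ⊢ s ∶ P
            → Γ ⊢ colam pos t (A ^ ⊖) (B ^ ⊕) s ∶ P
  colam⁻  : ∀ {Γ t s A B P} → Γ ⊢ t ∶ (A ⇒ B) ^ ⁻ → (B ^ ⊖ ∷ A ^ ⊕ ∷ Γ) ⊢ s ∶ P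
            → Γ ⊢ colam neg t (A ^ ⊕) (B ^ ⊖) s ∶ P
  negI⁺   : ∀ {Γ t A} → Γ ⊢ t ∶ A ^ ⊖ → Γ ⊢ negI pos t ∶ ¬ᵗ A ^ ⁺
  negI⁻   : ∀ {Γ t A} → Γ ⊢ t ∶ A ^ ⊕ → Γ ⊢ negI neg t ∶ ¬ᵗ A ^ ⁻
  negE⁺   : ∀ {Γ t A} → Γ ⊢ t ∶ ¬ᵗ A ^ ⁺ → Γ ⊢ negE pos t ∶ A ^ ⊖
  negE⁻   : ∀ {Γ t A} → Γ ⊢ t ∶ ¬ᵗ A ^ ⁻ → Γ ⊢ negE neg t ∶ A ^ ⊕
  tlam⁺   : ∀ {Γ t A} → ↑Γ Γ ⊢ t ∶ A ^ ⊕ → Γ ⊢ tlam pos t ∶ ∀ᵗ A ^ ⁺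
  tlam⁻   : ∀ {Γ t A} → ↑Γ Γ ⊢ t ∶ A ^ ⊖ → Γ ⊢ tlam neg t ∶ ∃ᵗ A ^ ⁻
  tapp⁺   : ∀ {Γ t B} A → Γ ⊢ t ∶ ∀ᵗ B ^ ⁺ → Γ ⊢ tapp pos t A ∶ (B [ A ]) ^ ⊕
  tapp⁻   : ∀ {Γ t B} A → Γ ⊢ t ∶ ∃ᵗ B ^ ⁻ → Γ ⊢ tapp neg t A ∶ (B [ A ]) ^ ⊖
  pack⁺   : ∀ {Γ t} A B → Γ ⊢ t ∶ (B [ A ]) ^ ⊕ → Γ ⊢ pack pos A t ∶ ∃ᵗ B ^ ⁺
  pack⁻   : ∀ {Γ t} A B → Γ ⊢ t ∶ (B [ A ]) ^ ⊖ → Γ ⊢ pack neg A t ∶ ∀ᵗ B ^ ⁻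
  open⁺   : ∀ {Γ t s A P} → Γ ⊢ t ∶ ∃ᵗ A ^ ⁺ → (A ^ ⊕ ∷ ↑Γ Γ) ⊢ s ∶ shiftM P
            → Γ ⊢ open' pos t (A ^ ⊕) s ∶ P
  open⁻   : ∀ {Γ t s A P} → Γ ⊢ t ∶ ∀ᵗ A ^ ⁻ → (A ^ ⊖ ∷ ↑Γ Γ) ⊢ s ∶ shiftM P
            → Γ ⊢ open' neg t (A ^ ⊖) s ∶ P

NoUsefulOcc : ℕ → Term → Set
NoUsefulOcc k (var x)             = ¬ (x ≡ k)
NoUsefulOcc k (abs t P s)         = NoUsefulOcc k t × NoUsefulOcc k s
NoUsefulOcc k (lamo ε P t)        = NoUsefulOcc (suc k) t
NoUsefulOcc k (appo pos t s)      = NoUsefulOcc k t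
NoUsefulOcc k (appo neg t s)      = NoUsefulOcc k t × NoUsefulOcc k s
NoUsefulOcc k (pair ε t s)        = NoUsefulOcc k t × NoUsefulOcc k s
NoUsefulOcc k (proj ε i t)        = NoUsefulOcc k t
NoUsefulOcc k (inj ε i t)         = NoUsefulOcc k t
NoUsefulOcc k (case ε t P s Q u)  = NoUsefulOcc k t × NoUsefulOcc (suc k) s × NoUsefulOcc (suc k) u
NoUsefulOcc k (lam ε P t)         = NoUsefulOcc (suc k) t
NoUsefulOcc k (app ε t s)         = NoUsefulOcc k t × NoUsefulOcc k s
NoUsefulOcc k (cpair ε t s)       = NoUsefulOcc k t × NoUsefulOcc k s
NoUsefulOcc k (colam ε t P Q s)   = NoUsefulOcc k t × NoUsefulOcc (suc (suc k)) s
NoUsefulOcc k (negI ε t)          = NoUsefulOcc k t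
NoUsefulOcc k (negE ε t)          = NoUsefulOcc k t
NoUsefulOcc k (tlam ε t)          = NoUsefulOcc k t
NoUsefulOcc k (tapp ε t A)        = NoUsefulOcc k t
NoUsefulOcc k (pack ε A t)        = NoUsefulOcc k t
NoUsefulOcc k (open' ε t P s)     = NoUsefulOcc k t × NoUsefulOcc (suc k) s

Intuitionistic : Term → Set
Intuitionistic (var x)              = ⊤
Intuitionistic (abs t P s)          = Intuitionistic t × Intuitionistic s
Intuitionistic (lamo pos P t)       = NoUsefulOcc 0 t × Intuitionistic t
Intuitionistic (lamo neg P t)       = Intuitionistic t
Intuitionistic (appo pos t s)       = Intuitionistic t
Intuitionistic (appo neg t s)       = Intuitionistic t × Intuitionistic s
Intuitionistic (pair ε t s)         = Intuitionistic t × Intuitionistic s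
Intuitionistic (proj ε i t)         = Intuitionistic t
Intuitionistic (inj ε i t)          = Intuitionistic t
Intuitionistic (case pos t P s Q u) = Intuitionistic t × Intuitionistic s × Intuitionistic u
Intuitionistic (case neg t P s Q u) = ⊥
Intuitionistic (lam ε P t)          = Intuitionistic t
Intuitionistic (app ε t s)          = Intuitionistic t × Intuitionistic s
Intuitionistic (cpair ε t s)        = Intuitionistic t × Intuitionistic s
Intuitionistic (colam pos t P Q s)  = Intuitionistic t × Intuitionistic s
Intuitionistic (colam neg t P Q s)  = ⊥
Intuitionistic (negI ε t)           = Intuitionistic t
Intuitionistic (negE pos t)         = Intuitionistic t
Intuitionistic (negE neg t)         = ⊥
Intuitionistic (tlam ε t)           = Intuitionistic t
Intuitionistic (tapp ε t A)         = Intuitionistic t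
Intuitionistic (pack ε A t)         = Intuitionistic t
Intuitionistic (open' pos t P s)    = Intuitionistic t × Intuitionistic s
Intuitionistic (open' neg t P s)    = ⊥

_⊢PRJ_∶_ : List MTy → Term → MTy → Set
Γ ⊢PRJ t ∶ P = (Γ ⊢ t ∶ P) × Intuitionistic t

infix 4 _⊢PRJ_∶_

data Fm : Set where
  fv    : ℕ → Fm
  ⊥ᶠ    : Fm
  _∧ᶠ_  : Fm → Fm → Fm
  _∨ᶠ_  : Fm → Fm → Fm
  _⇒ᶠ_  : Fm → Fm → Fm
  _⋉ᶠ_  : Fm → Fm → Fm
  ¬ᶠ    : Fm → Fm
  ∀ᶠ    : Fm → Fm
  ∃ᶠ    : Fm → Fm

shiftᶠ : ℕ → Fm → Fm
shiftᶠ c (fv n)   = if n <ᵇ c then fv n else fv (suc n)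
shiftᶠ c ⊥ᶠ       = ⊥ᶠ
shiftᶠ c (A ∧ᶠ B) = shiftᶠ c A ∧ᶠ shiftᶠ c B
shiftᶠ c (A ∨ᶠ B) = shiftᶠ c A ∨ᶠ shiftᶠ c B
shiftᶠ c (A ⇒ᶠ B) = shiftᶠ c A ⇒ᶠ shiftᶠ c B
shiftᶠ c (A ⋉ᶠ B) = shiftᶠ c A ⋉ᶠ shiftᶠ c B
shiftᶠ c (¬ᶠ A)   = ¬ᶠ (shiftᶠ c A)
shiftᶠ c (∀ᶠ A)   = ∀ᶠ (shiftᶠ (suc c) A)
shiftᶠ c (∃ᶠ A)   = ∃ᶠ (shiftᶠ (suc c) A)

substᶠ : ℕ → Fm → Fm → Fm
substᶠ j A (fv n)   = if n <ᵇ j then fv n else (if n ≡ᵇ j then A else fv (pred n))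
substᶠ j A ⊥ᶠ       = ⊥ᶠ
substᶠ j A (B ∧ᶠ C) = substᶠ j A B ∧ᶠ substᶠ j A C
substᶠ j A (B ∨ᶠ C) = substᶠ j A B ∨ᶠ substᶠ j A C
substᶠ j A (B ⇒ᶠ C) = substᶠ j A B ⇒ᶠ substᶠ j A C
substᶠ j A (B ⋉ᶠ C) = substᶠ j A B ⋉ᶠ substᶠ j A C
substᶠ j A (¬ᶠ B)   = ¬ᶠ (substᶠ j A B)
substᶠ j A (∀ᶠ B)   = ∀ᶠ (substᶠ (suc j) (shiftᶠ 0 A) B)
substᶠ j A (∃ᶠ B)   = ∃ᶠ (substᶠ (suc j) (shiftᶠ 0 A) B)

_[_]ᶠ : Fm → Fm → Fm
B [ A ]ᶠ = substᶠ 0 A B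

↑Δ : List Fm → List Fm
↑Δ = map (shiftᶠ 0)

infix 4 _⊢NJ_

data _⊢NJ_ : List Fm → Fm → Set where
  axNJ  : ∀ {Δ A} → A ∈ Δ → Δ ⊢NJ A
  ⊥E    : ∀ {Δ} A → Δ ⊢NJ ⊥ᶠ → Δ ⊢NJ A
  ∧I    : ∀ {Δ A B} → Δ ⊢NJ A → Δ ⊢NJ B → Δ ⊢NJ A ∧ᶠ B
  ∧E₁   : ∀ {Δ A B} → Δ ⊢NJ A ∧ᶠ B → Δ ⊢NJ A
  ∧E₂   : ∀ {Δ A B} → Δ ⊢NJ A ∧ᶠ B → Δ ⊢NJ B
  ∨I₁   : ∀ {Δ A} B → Δ ⊢NJ A → Δ ⊢NJ A ∨ᶠ B
  ∨I₂   : ∀ {Δ B} A → Δ ⊢NJ B → Δ ⊢NJ A ∨ᶠ B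
  ∨E    : ∀ {Δ A B C} → Δ ⊢NJ A ∨ᶠ B → (A ∷ Δ) ⊢NJ C → (B ∷ Δ) ⊢NJ C → Δ ⊢NJ C
  ⇒I    : ∀ {Δ A B} → (A ∷ Δ) ⊢NJ B → Δ ⊢NJ A ⇒ᶠ B
  ⇒E    : ∀ {Δ A B} → Δ ⊢NJ A ⇒ᶠ B → Δ ⊢NJ A → Δ ⊢NJ B
  ¬I    : ∀ {Δ A} → (A ∷ Δ) ⊢NJ ⊥ᶠ → Δ ⊢NJ ¬ᶠ A
  ¬E    : ∀ {Δ A} → Δ ⊢NJ ¬ᶠ A → Δ ⊢NJ A → Δ ⊢NJ ⊥ᶠ
  ⋉I    : ∀ {Δ A B} → Δ ⊢NJ ¬ᶠ A → Δ ⊢NJ B → Δ ⊢NJ A ⋉ᶠ B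
  ⋉E    : ∀ {Δ A B C} → Δ ⊢NJ A ⋉ᶠ B → (B ∷ ¬ᶠ A ∷ Δ) ⊢NJ C → Δ ⊢NJ C
  ∀I    : ∀ {Δ A} → ↑Δ Δ ⊢NJ A → Δ ⊢NJ ∀ᶠ A
  ∀E    : ∀ {Δ B} A → Δ ⊢NJ ∀ᶠ B → Δ ⊢NJ B [ A ]ᶠ
  ∃I    : ∀ {Δ} A B → Δ ⊢NJ B [ A ]ᶠ → Δ ⊢NJ ∃ᶠ B
  ∃E    : ∀ {Δ A B} → Δ ⊢NJ ∃ᶠ A → (A ∷ ↑Δ Δ) ⊢NJ shiftᶠ 0 B → Δ ⊢NJ B

emb : Ty → Fm
emb (tv n)  = fv n
emb (A ∧ B) = emb A ∧ᶠ emb B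
emb (A ∨ B) = emb A ∨ᶠ emb B
emb (A ⇒ B) = emb A ⇒ᶠ emb B
emb (A ⋉ B) = emb A ⋉ᶠ emb B
emb (¬ᵗ A)  = ¬ᶠ (emb A)
emb (∀ᵗ A)  = ∀ᶠ (emb A)
emb (∃ᵗ A)  = ∃ᶠ (emb A)

⌊_⌋ : MTy → Fm
⌊ A ^ ⁺ ⌋ = emb A
⌊ A ^ ⊕ ⌋ = emb A
⌊ A ^ ⁻ ⌋ = ¬ᶠ (emb A)
⌊ A ^ ⊖ ⌋ = ¬ᶠ (emb A)

{-# OPTIONS --safe #-}
module Submission where

open import Defs
open import Data.List using (List; map; _∷_)
open import Data.Nat using (ℕ; suc; _<ᵇ_; _≡ᵇ_)
open import Data.Bool using (true; false)
open import Data.Sum using (_⊎_; inj₁; inj₂) renaming (map to map⊎)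
open import Data.Product using (_×_; _,_; proj₁; proj₂; ∃-syntax)
open import Data.Empty using (⊥-elim)
open import Function using (id; _∘_)
open import Data.List.Relation.Unary.Any using (here; there)
open import Data.List.Membership.Propositional using (_∈_)
open import Data.List.Membership.Propositional.Properties using (∈-map⁺)
open import Data.List.Relation.Binary.Subset.Propositional using (_⊆_)
open import Data.List.Relation.Binary.Subset.Propositional.Properties using (∷⁺ʳ; map⁺)
open import Relation.Binary.PropositionalEquality as ≡ using (_≡_; refl; cong; cong₂; sym; trans)

-- Read ⊕ and + as proofs and ⊖ and − as refutations. Every positive rule of λ^PRK is then
-- an NJ rule and every negative one an intuitionistic contraposition (¬(A ∨ B) from ¬A and
-- ¬B, ¬(A ⋉ B) from ¬A ⊢ ¬B, ¬∃α.A from ¬A, …). Only two kinds of rule are classical: the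
-- negative eliminations case⁻, colam⁻, ¬E⁻, open⁻, which intuitionistic terms exclude, and
-- λ⁺∘, whose hypothesis x : A⊖ would have to be justified by ¬A. But x has no useful
-- occurrence, and t ∘⁺ s translates as t alone, dropping the only place where x may occur;
-- so the translation needs the formulas of the usefully occurring hypotheses only.

emb-shift : ∀ c A → emb (shift c A) ≡ shiftᶠ c (emb A)
emb-shift c (tv n) with n <ᵇ c
... | true  = refl
... | false = refl
emb-shift c (A ∧ B) = cong₂ _∧ᶠ_ (emb-shift c A) (emb-shift c B)
emb-shift c (A ∨ B) = cong₂ _∨ᶠ_ (emb-shift c A) (emb-shift c B)
emb-shift c (A ⇒ B) = cong₂ _⇒ᶠ_ (emb-shift c A) (emb-shift c B)
emb-shift c (A ⋉ B) = cong₂ _⋉ᶠ_ (emb-shift c A) (emb-shift c B)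
emb-shift c (¬ᵗ A)  = cong ¬ᶠ (emb-shift c A)
emb-shift c (∀ᵗ A)  = cong ∀ᶠ (emb-shift (suc c) A)
emb-shift c (∃ᵗ A)  = cong ∃ᶠ (emb-shift (suc c) A)

emb-subst : ∀ j A B → emb (subst j A B) ≡ substᶠ j (emb A) (emb B)
emb-subst-under-binder : ∀ j A B
  → emb (subst (suc j) (shift 0 A) B) ≡ substᶠ (suc j) (shiftᶠ 0 (emb A)) (emb B)

emb-subst j A (tv n) with n <ᵇ j | n ≡ᵇ j
... | true  | _     = refl
... | false | true  = refl
... | false | false = refl
emb-subst j A (B ∧ C) = cong₂ _∧ᶠ_ (emb-subst j A B) (emb-subst j A C)
emb-subst j A (B ∨ C) = cong₂ _∨ᶠ_ (emb-subst j A B) (emb-subst j A C)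
emb-subst j A (B ⇒ C) = cong₂ _⇒ᶠ_ (emb-subst j A B) (emb-subst j A C)
emb-subst j A (B ⋉ C) = cong₂ _⋉ᶠ_ (emb-subst j A B) (emb-subst j A C)
emb-subst j A (¬ᵗ B)  = cong ¬ᶠ (emb-subst j A B)
emb-subst j A (∀ᵗ B)  = cong ∀ᶠ (emb-subst-under-binder j A B)
emb-subst j A (∃ᵗ B)  = cong ∃ᶠ (emb-subst-under-binder j A B)

emb-subst-under-binder j A B =
  trans (emb-subst (suc j) (shift 0 A) B) (cong (λ A′ → substᶠ (suc j) A′ (emb B)) (emb-shift 0 A))

emb-[] : ∀ B A → emb (B [ A ]) ≡ emb B [ emb A ]ᶠ
emb-[] B A = emb-subst 0 A B

⌊⌋-shiftM : ∀ P → ⌊ shiftM P ⌋ ≡ shiftᶠ 0 ⌊ P ⌋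
⌊⌋-shiftM (A ^ ⁺) = emb-shift 0 A
⌊⌋-shiftM (A ^ ⁻) = cong ¬ᶠ (emb-shift 0 A)
⌊⌋-shiftM (A ^ ⊕) = emb-shift 0 A
⌊⌋-shiftM (A ^ ⊖) = cong ¬ᶠ (emb-shift 0 A)

weaken : ∀ {Δ Δ′ A} → Δ ⊆ Δ′ → Δ ⊢NJ A → Δ′ ⊢NJ A
weaken w (axNJ m)   = axNJ (w m)
weaken w (⊥E A d)   = ⊥E A (weaken w d)
weaken w (∧I d e)   = ∧I (weaken w d) (weaken w e)
weaken w (∧E₁ d)    = ∧E₁ (weaken w d)
weaken w (∧E₂ d)    = ∧E₂ (weaken w d)
weaken w (∨I₁ B d)  = ∨I₁ B (weaken w d)
weaken w (∨I₂ A d)  = ∨I₂ A (weaken w d)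
weaken w (∨E d e f) = ∨E (weaken w d) (weaken (∷⁺ʳ _ w) e) (weaken (∷⁺ʳ _ w) f)
weaken w (⇒I d)     = ⇒I (weaken (∷⁺ʳ _ w) d)
weaken w (⇒E d e)   = ⇒E (weaken w d) (weaken w e)
weaken w (¬I d)     = ¬I (weaken (∷⁺ʳ _ w) d)
weaken w (¬E d e)   = ¬E (weaken w d) (weaken w e)
weaken w (⋉I d e)   = ⋉I (weaken w d) (weaken w e)
weaken w (⋉E d e)   = ⋉E (weaken w d) (weaken (∷⁺ʳ _ (∷⁺ʳ _ w)) e)
weaken w (∀I d)     = ∀I (weaken (map⁺ _ w) d)
weaken w (∀E A d)   = ∀E A (weaken w d)
weaken w (∃I A B d) = ∃I A B (weaken w d)
weaken w (∃E d e)   = ∃E (weaken w d) (weaken (∷⁺ʳ _ (map⁺ _ w)) e)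

private variable
  Δ : List Fm
  A B C : Fm

hyp₀ : (A ∷ Δ) ⊢NJ A
hyp₀ = axNJ (here refl)

weaken₁ : Δ ⊢NJ A → (B ∷ Δ) ⊢NJ A
weaken₁ = weaken there

weaken₂ : Δ ⊢NJ A → (B ∷ C ∷ Δ) ⊢NJ A
weaken₂ = weaken (λ m → there (there m))

contrapose : Δ ⊢NJ ¬ᶠ B → (A ∷ Δ) ⊢NJ B → Δ ⊢NJ ¬ᶠ A
contrapose ¬b a⊢b = ¬I (¬E (weaken₁ ¬b) a⊢b)

¬I-self : (A ∷ Δ) ⊢NJ ¬ᶠ A → Δ ⊢NJ ¬ᶠ A
¬I-self a⊢¬a = ¬I (¬E a⊢¬a hyp₀)

¬¬-intro : Δ ⊢NJ A → Δ ⊢NJ ¬ᶠ (¬ᶠ A)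
¬¬-intro a = ¬I (¬E hyp₀ (weaken₁ a))

¬∨-intro : Δ ⊢NJ ¬ᶠ A → Δ ⊢NJ ¬ᶠ B → Δ ⊢NJ ¬ᶠ (A ∨ᶠ B)
¬∨-intro ¬a ¬b = ¬I (∨E hyp₀ (¬E (weaken₂ ¬a) hyp₀)
                             (¬E (weaken₂ ¬b) hyp₀))

¬⋉-intro : (¬ᶠ A ∷ Δ) ⊢NJ ¬ᶠ B → Δ ⊢NJ ¬ᶠ (A ⋉ᶠ B)
¬⋉-intro ¬a⊢¬b = ¬I (⋉E hyp₀ (¬E (weaken (there ∘ ∷⁺ʳ _ there) ¬a⊢¬b) hyp₀))

¬∃-intro : ↑Δ Δ ⊢NJ ¬ᶠ A → Δ ⊢NJ ¬ᶠ (∃ᶠ A)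
¬∃-intro ¬a = ¬I (∃E {B = ⊥ᶠ} hyp₀ (¬E (weaken₂ ¬a) hyp₀))

∧E-sel : ∀ i {A₁ A₂} → Δ ⊢NJ emb A₁ ∧ᶠ emb A₂ → Δ ⊢NJ emb (sel i A₁ A₂)
∧E-sel i₁ = ∧E₁
∧E-sel i₂ = ∧E₂

∨I-sel : ∀ i {A₁ A₂} → Δ ⊢NJ emb (sel i A₁ A₂) → Δ ⊢NJ emb A₁ ∨ᶠ emb A₂
∨I-sel i₁ = ∨I₁ _
∨I-sel i₂ = ∨I₂ _

∀E-emb : ∀ A {B} → Δ ⊢NJ ∀ᶠ (emb B) → Δ ⊢NJ emb (B [ A ])
∀E-emb A {B} d = ≡.subst (_ ⊢NJ_) (sym (emb-[] B A)) (∀E (emb A) d)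

∃I-emb : ∀ A B → Δ ⊢NJ emb (B [ A ]) → Δ ⊢NJ ∃ᶠ (emb B)
∃I-emb A B d = ∃I (emb A) (emb B) (≡.subst (_ ⊢NJ_) (emb-[] B A) d)

∋-↑Γ⁻ : ∀ Γ {x P′} → ↑Γ Γ ∋ x ∶ P′ → ∃[ P ] (Γ ∋ x ∶ P) × P′ ≡ shiftM P
∋-↑Γ⁻ (Q ∷ Γ) here      = Q , here , refl
∋-↑Γ⁻ (Q ∷ Γ) (there v) with ∋-↑Γ⁻ Γ v
... | P , w , refl = P , there w , refl

∋⇒⌊⌋∈ : ∀ {Γ x P} → Γ ∋ x ∶ P → ⌊ P ⌋ ∈ map ⌊_⌋ Γ
∋⇒⌊⌋∈ here      = here refl
∋⇒⌊⌋∈ (there v) = there (∋⇒⌊⌋∈ v)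

⌊⌋∈-↑Δ : ∀ P {Δ} → ⌊ P ⌋ ∈ Δ → ⌊ shiftM P ⌋ ∈ ↑Δ Δ
⌊⌋∈-↑Δ P {Δ} m = ≡.subst (_∈ ↑Δ Δ) (sym (⌊⌋-shiftM P)) (∈-map⁺ (shiftᶠ 0) m)

record Covers (Γ : List MTy) (U : ℕ → Set) (Δ : List Fm) : Set where
  constructor covers
  field lookup : ∀ {x P} → Γ ∋ x ∶ P → U x ⊎ ⌊ P ⌋ ∈ Δ
open Covers

module _ {Γ : List MTy} {Δ : List Fm} where

  covers-map : ∀ {U V : ℕ → Set} → (∀ {x} → U x → V x) → Covers Γ U Δ → Covers Γ V Δ
  covers-map f c = covers λ v → map⊎ f id (lookup c v)

  covers-∷ : ∀ {U P} → Covers Γ (λ x → U (suc x)) Δ → Covers (P ∷ Γ) U (⌊ P ⌋ ∷ Δ)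
  covers-∷ c = covers λ where
    here      → inj₂ (here refl)
    (there v) → map⊎ id there (lookup c v)

  covers-∷-unused : ∀ {U P} → U 0 → Covers Γ (λ x → U (suc x)) Δ → Covers (P ∷ Γ) U Δ
  covers-∷-unused u c = covers λ where
    here      → inj₁ u
    (there v) → lookup c v

  covers-↑ : ∀ {U} → Covers Γ U Δ → Covers (↑Γ Γ) U (↑Δ Δ)
  covers-↑ {U} c = covers lookup-↑
    where
    lookup-↑ : ∀ {x P′} → ↑Γ Γ ∋ x ∶ P′ → U x ⊎ ⌊ P′ ⌋ ∈ ↑Δ Δ
    lookup-↑ v with ∋-↑Γ⁻ Γ v
    ... | P , w , refl = map⊎ id (⌊⌋∈-↑Δ P) (lookup c w)

translate : ∀ {Γ t Q Δ} → Γ ⊢ t ∶ Q → Intuitionistic t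
  → Covers Γ (λ x → NoUsefulOcc x t) Δ → Δ ⊢NJ ⌊ Q ⌋
translate (ax v) _ c with lookup c v
... | inj₁ unused = ⊥-elim (unused refl)
... | inj₂ m      = axNJ m
translate (absurd P d e) (i , j) c =
  ⊥E ⌊ P ⌋ (¬E (translate e j (covers-map proj₂ c)) (translate d i (covers-map proj₁ c)))
translate (lamo⁺ d) (unused , i) c = translate d i (covers-∷-unused unused c)
translate (lamo⁻ d) i c = ¬I-self (translate d i (covers-∷ c))
translate (appo⁺ d _) i c = translate d i c
translate (appo⁻ d _) (i , _) c = translate d i (covers-map proj₁ c)
translate (pair⁺ d e) (i , j) c =
  ∧I (translate d i (covers-map proj₁ c)) (translate e j (covers-map proj₂ c))
translate (pair⁻ d e) (i , j) c =
  ¬∨-intro (translate d i (covers-map proj₁ c)) (translate e j (covers-map proj₂ c))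
translate (proj⁺ k d) i c = ∧E-sel k (translate d i c)
translate (proj⁻ k d) i c = contrapose (translate d i c) (∨I-sel k hyp₀)
translate (inj⁺ _ _ k d) i c = ∨I-sel k (translate d i c)
translate (inj⁻ _ _ k d) i c = contrapose (translate d i c) (∧E-sel k hyp₀)
translate (case⁺ d e f) (i , j , k) c =
  ∨E (translate d i (covers-map proj₁ c))
     (translate e j (covers-∷ (covers-map (λ u → proj₁ (proj₂ u)) c)))
     (translate f k (covers-∷ (covers-map (λ u → proj₂ (proj₂ u)) c)))
translate (lam⁺ d) i c = ⇒I (translate d i (covers-∷ c))
translate (lam⁻ d) i c = ¬⋉-intro (translate d i (covers-∷ c))
translate (app⁺ d e) (i , j) c =
  ⇒E (translate d i (covers-map proj₁ c)) (translate e j (covers-map proj₂ c))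
translate (app⁻ d e) (i , j) c =
  contrapose (translate d i (covers-map proj₁ c)) (⋉I (weaken₁ (translate e j (covers-map proj₂ c))) hyp₀)
translate (cpair⁺ d e) (i , j) c =
  ⋉I (translate d i (covers-map proj₁ c)) (translate e j (covers-map proj₂ c))
translate (cpair⁻ d e) (i , j) c =
  contrapose (translate e j (covers-map proj₂ c)) (⇒E hyp₀ (weaken₁ (translate d i (covers-map proj₁ c))))
translate (colam⁺ d e) (i , j) c =
  ⋉E (translate d i (covers-map proj₁ c)) (translate e j (covers-∷ (covers-∷ (covers-map proj₂ c))))
translate (negI⁺ d) i c = translate d i c
translate (negI⁻ d) i c = ¬¬-intro (translate d i c)
translate (negE⁺ d) i c = translate d i c
translate (tlam⁺ d) i c = ∀I (translate d i (covers-↑ c))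
translate (tlam⁻ d) i c = ¬∃-intro (translate d i (covers-↑ c))
translate (tapp⁺ A d) i c = ∀E-emb A (translate d i c)
translate (tapp⁻ {B = B} A d) i c = contrapose (translate d i c) (∃I-emb A B hyp₀)
translate (pack⁺ A B d) i c = ∃I-emb A B (translate d i c)
translate (pack⁻ A B d) i c = contrapose (translate d i c) (∀E-emb A hyp₀)
translate (open⁺ {P = P} d e) (i , j) c =
  ∃E (translate d i (covers-map proj₁ c))
     (≡.subst (_ ⊢NJ_) (⌊⌋-shiftM P) (translate e j (covers-∷ (covers-↑ (covers-map proj₂ c)))))

lemma51 : (Γ : List MTy) (t : Term) (Q : MTy)
    → Γ ⊢PRJ t ∶ Q
    → map ⌊_⌋ Γ ⊢NJ ⌊ Q ⌋
lemma51 Γ t Q (d , i) = translate d i (covers (inj₂ ∘ ∋⇒⌊⌋∈))
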